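{- Let $E[\;]$ be a unary and $C[\;,\;]$ a binary CCS context, and let $P,Q,P',Q',U$ be CCS processes. If $E[C[P,Q]]\xrightarrow{\tau}$ and $U\xrightarrow{\tau}$, but neither $E[C[P',Q]]\xrightarrow{\tau}$, nor $E[C[P,Q']]\xrightarrow{\tau}$, nor $E[U]\xrightarrow{\tau}\xrightarrow{\tau}$, then $C[P,Q]\xrightarrow{\tau}$.
   Context: CCS is Milner's calculus with prefixing $\alpha.E$, arbitrary sums $\sum_{i\in I}E_i$, parallel composition $E|F$ (handshake of $a$ and $\bar a$ yields $\tau$), restriction $E\backslash L$, relabelling $E[f]$ (with $f(\tau)=\tau$), and agent identifiers with defining equations, under its standard structural operational semantics. An $n$-ary CCS context is a CCS expression that may contain variables (holes) $X_1,\dots,X_n$; $C[P_1,\dots,P_n]$ denotes the result of substituting $P_i$ for $X_i$. $R\xrightarrow{\tau}$ means $R\xrightarrow{\tau}R'$ for some $R'$, and $R\xrightarrow{\tau}\xrightarrow{\tau}$ means there are two consecutive $\tau$-transitions from $R$. -}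

module Defs where

open import Data.Empty using (⊥)
open import Data.Unit using (⊤)
open import Data.Product using (Σ; _×_)
open import Data.Fin using (Fin)
open import Data.Nat using (ℕ)
open import Data.Vec using (Vec; lookup; _∷_; [])
open import Relation.Nullary using (¬_)

data Act (N : Set) : Set where
  τ  : Act N
  nm : N → Act N
  co : N → Act N

relabel : {N : Set} → (N → N) → Act N → Act N
relabel f τ      = τ
relabel f (nm a) = nm (f a)
relabel f (co a) = co (f a)

-- α ∉ L ∪ \overline{L}  (τ is never restricted); L ⊆ N is given as a predicate.
Allowed : {N : Set} → (N → Set) → Act N → Set
Allowed L τ      = ⊤
Allowed L (nm a) = ¬ L a
Allowed L (co a) = ¬ L a

-- CCS expressions with variables (holes) from V.
data Expr (N Id V : Set) : Set₁ where
  var   : V → Expr N Id V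
  pre   : Act N → Expr N Id V → Expr N Id V
  sum   : (I : Set) → (I → Expr N Id V) → Expr N Id V
  par   : Expr N Id V → Expr N Id V → Expr N Id V
  res   : Expr N Id V → (N → Set) → Expr N Id V
  ren   : Expr N Id V → (N → N) → Expr N Id V
  ident : Id → Expr N Id V

Proc : Set → Set → Set₁
Proc N Id = Expr N Id ⊥

subst : {N Id V W : Set} → Expr N Id V → (V → Expr N Id W) → Expr N Id W
subst (var x)     σ = σ x
subst (pre α E)   σ = pre α (subst E σ)
subst (sum I F)   σ = sum I (λ i → subst (F i) σ)
subst (par E F)   σ = par (subst E σ) (subst F σ)
subst (res E L)   σ = res (subst E σ) L
subst (ren E f)   σ = ren (subst E σ) f
subst (ident A)   σ = ident A

_⟦_⟧ : {N Id : Set} {n : ℕ} → Expr N Id (Fin n) → Vec (Proc N Id) n → Proc N Id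
C ⟦ Ps ⟧ = subst C (lookup Ps)

-- Structural operational semantics, relative to defining equations Δ : A ≝ Δ A.
data Step {N Id : Set} (Δ : Id → Proc N Id) : Proc N Id → Act N → Proc N Id → Set₁ where
  act   : ∀ {α P} → Step Δ (pre α P) α P
  sumᵢ  : ∀ {I F α P'} (i : I) → Step Δ (F i) α P' → Step Δ (sum I F) α P'
  parₗ  : ∀ {P Q α P'} → Step Δ P α P' → Step Δ (par P Q) α (par P' Q)
  parᵣ  : ∀ {P Q α Q'} → Step Δ Q α Q' → Step Δ (par P Q) α (par P Q')
  comₗ  : ∀ {P Q a P' Q'} → Step Δ P (nm a) P' → Step Δ Q (co a) Q' → Step Δ (par P Q) τ (par P' Q')
  comᵣ  : ∀ {P Q a P' Q'} → Step Δ P (co a) P' → Step Δ Q (nm a) Q' → Step Δ (par P Q) τ (par P' Q')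
  resₛ  : ∀ {P L α P'} → Step Δ P α P' → Allowed L α → Step Δ (res P L) α (res P' L)
  renₛ  : ∀ {P f α P'} → Step Δ P α P' → Step Δ (ren P f) (relabel f α) (ren P' f)
  identₛ : ∀ {A α P'} → Step Δ (Δ A) α P' → Step Δ (ident A) α P'

HasTau : {N Id : Set} → (Id → Proc N Id) → Proc N Id → Set₁
HasTau Δ R = Σ _ (λ R' → Step Δ R τ R')

HasTauTau : {N Id : Set} → (Id → Proc N Id) → Proc N Id → Set₁
HasTauTau Δ R = Σ _ (λ R' → Σ _ (λ R'' → Step Δ R τ R' × Step Δ R' τ R''))

module Submission where

open import Defs
open import Data.Empty using (⊥-elim)
open import Data.Fin using (Fin; zero; suc)
open import Data.Product using (Σ; _,_)
open import Data.Unit using (tt)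
open import Data.Vec using (_∷_; []; lookup)
open import Function using (id)
open import Relation.Binary.PropositionalEquality using (_≡_; _≢_; refl)
open import Relation.Nullary using (¬_)

-- Every step of E[σ] comes from E itself (and survives any change of the fillers), from a
-- single hole in an active position (and is inherited from whatever that hole can do), or
-- from a handshake between two hole occurrences (and then any fillers that can all do τ give
-- E two consecutive τ-steps). For E this leaves only the middle option, by the hypotheses on
-- P' and U, so the τ-step of E[C[P,Q]] is inherited from a step of C[P,Q]. For C the
-- hypotheses on P' and Q' leave only the handshake, which is a τ-step.

module _ {N Id : Set} (Δ : Id → Proc N Id) where

  Filling : Set → Set₁
  Filling V = V → Proc N Id

  CanStep : Proc N Id → Act N → Set₁
  CanStep R α = Σ (Proc N Id) (Step Δ R α)

  data Origin {V : Set} (T : Filling V → Proc N Id) (σ : Filling V) (α : Act N) : Set₁ where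
    static    : (∀ σ' → CanStep (T σ') α) → Origin T σ α
    hole      : (v : V) (β : Act N) → CanStep (σ v) β →
                (∀ σ' → CanStep (σ' v) β → CanStep (T σ') α) →
                (∀ σ' → CanStep (σ' v) τ → CanStep (T σ') τ) → Origin T σ α
    handshake : α ≡ τ → (∀ σ' → (∀ v → CanStep (σ' v) τ) → HasTauTau Δ (T σ')) → Origin T σ α

  liftTauTau : {T : Proc N Id → Proc N Id} →
               (∀ {R R'} → Step Δ R τ R' → Step Δ (T R) τ (T R')) →
               ∀ {R} → HasTauTau Δ R → HasTauTau Δ (T R)
  liftTauTau lift (_ , _ , t , u) = _ , _ , lift t , lift u

  mapOrigin : {V : Set} {T T' : Filling V → Proc N Id} {σ : Filling V} {α α' : Act N} →
              (∀ {σ'} → CanStep (T σ') α → CanStep (T' σ') α') →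
              (∀ {σ'} → CanStep (T σ') τ → CanStep (T' σ') τ) →
              (∀ {σ'} → HasTauTau Δ (T σ') → HasTauTau Δ (T' σ')) →
              (α ≡ τ → α' ≡ τ) →
              Origin T σ α → Origin T' σ α'
  mapOrigin f _ _ _ (static p) = static λ σ' → f (p σ')
  mapOrigin f fτ _ _ (hole v β w fire fireτ) =
    hole v β w (λ σ' k → f (fire σ' k)) (λ σ' k → fτ (fireτ σ' k))
  mapOrigin _ _ fττ keepτ (handshake α≡τ twice) =
    handshake (keepτ α≡τ) λ σ' k → fττ (twice σ' k)

  syncOrigin : {V : Set} {T T' : Filling V → Proc N Id} {σ : Filling V} {a b : Act N} →
               a ≢ τ → b ≢ τ →
               (∀ {σ'} → CanStep (T σ') a → CanStep (T' σ') b →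
                         CanStep (par (T σ') (T' σ')) τ) →
               Origin T σ a → Origin T' σ b → Origin (λ σ' → par (T σ') (T' σ')) σ τ
  syncOrigin a≢τ _ _ (handshake a≡τ _) _ = ⊥-elim (a≢τ a≡τ)
  syncOrigin _ b≢τ _ _ (handshake b≡τ _) = ⊥-elim (b≢τ b≡τ)
  syncOrigin _ _ sync (static p) (static q) = static λ σ' → sync (p σ') (q σ')
  syncOrigin _ _ sync (static p) (hole v β w fire fireτ) =
    hole v β w (λ σ' k → sync (p σ') (fire σ' k))
               (λ σ' k → let (_ , u) = fireτ σ' k in _ , parᵣ u)
  syncOrigin _ _ sync (hole v β w fire fireτ) (static q) =
    hole v β w (λ σ' k → sync (fire σ' k) (q σ'))
               (λ σ' k → let (_ , t) = fireτ σ' k in _ , parₗ t)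
  -- The two holes are in active positions on either side of |, so their τ-steps can be
  -- performed one after the other.
  syncOrigin _ _ _ (hole v _ _ _ fireτ) (hole v' _ _ _ fireτ') =
    handshake refl λ σ' k → let (_ , t) = fireτ σ' (k v) ; (_ , u) = fireτ' σ' (k v') in
                            _ , _ , parₗ t , parᵣ u

  origin : {V : Set} (E : Expr N Id V) (σ : Filling V) {α : Act N} {S : Proc N Id} →
           Step Δ (subst E σ) α S → Origin (subst E) σ α
  origin (var v) σ s = hole v _ (_ , s) (λ _ k → k) (λ _ k → k)
  origin (pre α E) σ act = static λ _ → _ , act
  origin (sum I F) σ (sumᵢ i s) =
    mapOrigin (λ (_ , t) → _ , sumᵢ i t) (λ (_ , t) → _ , sumᵢ i t)
              (λ (_ , _ , t , u) → _ , _ , sumᵢ i t , u) id (origin (F i) σ s)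
  origin (par E F) σ (parₗ s) =
    mapOrigin (λ (_ , t) → _ , parₗ t) (λ (_ , t) → _ , parₗ t)
              (liftTauTau parₗ) id (origin E σ s)
  origin (par E F) σ (parᵣ s) =
    mapOrigin (λ (_ , t) → _ , parᵣ t) (λ (_ , t) → _ , parᵣ t)
              (liftTauTau parᵣ) id (origin F σ s)
  origin (par E F) σ (comₗ s r) =
    syncOrigin (λ ()) (λ ()) (λ (_ , t) (_ , u) → _ , comₗ t u) (origin E σ s) (origin F σ r)
  origin (par E F) σ (comᵣ s r) =
    syncOrigin (λ ()) (λ ()) (λ (_ , t) (_ , u) → _ , comᵣ t u) (origin E σ s) (origin F σ r)
  origin (res E L) σ (resₛ s allowed) =
    mapOrigin (λ (_ , t) → _ , resₛ t allowed) (λ (_ , t) → _ , resₛ t tt)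
              (liftTauTau (λ t → resₛ t tt)) id (origin E σ s)
  origin (ren E f) σ (renₛ s) =
    mapOrigin (λ (_ , t) → _ , renₛ t) (λ (_ , t) → _ , renₛ t)
              (liftTauTau renₛ) (λ { refl → refl }) (origin E σ s)
  origin (ident A) σ (identₛ s) = static λ _ → _ , identₛ s

lemma1 : {N Id : Set} (Δ : Id → Proc N Id)
         (E : Expr N Id (Fin 1)) (C : Expr N Id (Fin 2))
         (P Q P' Q' U : Proc N Id) →
         HasTau Δ (E ⟦ (C ⟦ P ∷ Q ∷ [] ⟧) ∷ [] ⟧) →
         HasTau Δ U →
         ¬ HasTau Δ (E ⟦ (C ⟦ P' ∷ Q ∷ [] ⟧) ∷ [] ⟧) →
         ¬ HasTau Δ (E ⟦ (C ⟦ P ∷ Q' ∷ [] ⟧) ∷ [] ⟧) →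
         ¬ HasTauTau Δ (E ⟦ U ∷ [] ⟧) →
         HasTau Δ (C ⟦ P ∷ Q ∷ [] ⟧)
lemma1 Δ E C P Q P' Q' U (_ , s) (_ , u) ¬P' ¬Q' ¬UU with origin Δ E _ s
... | static any        = ⊥-elim (¬P' (any _))
... | handshake _ twice = ⊥-elim (¬UU (twice _ λ { zero → _ , u }))
... | hole zero _ (_ , c) fire _ with origin Δ C _ c
...   | static any                  = ⊥-elim (¬P' (fire _ (any _)))
...   | hole zero _ w fireC _       = ⊥-elim (¬Q' (fire _ (fireC _ w)))
...   | hole (suc zero) _ w fireC _ = ⊥-elim (¬P' (fire _ (fireC _ w)))
...   | handshake refl _            = _ , c
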